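{- Let $\varphi:\{a,b\}^*\to\{a,b\}^*$ be the morphism $\varphi(a)=abbabba$, $\varphi(b)=aba$, let $\mathbf{u}$ be its fixed point (starting with $a$), let $\Psi:\{a,b\}^*\to\{0,1,2\}^*$ be the morphism $\Psi(a)=12$, $\Psi(b)=100$, let $\mathbf{v}=\Psi(\mathbf{u})$, and define $H(w)=\Psi(w)1$. If $v$ is a bispecial factor of $\mathbf{v}$ of length at least $3$, then there exists a factor $w$ of $\mathbf{u}$ such that $v=H(w)$; moreover $b(w)=b(H(w))$ (bilateral order of $w$ in $\mathbf{u}$, of $H(w)$ in $\mathbf{v}$).
   Context: For an infinite word $\mathbf{x}$ with language $\mathcal{L}(\mathbf{x})$ (its set of finite factors) and a factor $w$, $\mathrm{Lext}(w)=\{c: cw\in\mathcal{L}(\mathbf{x})\}$, $\mathrm{Rext}(w)=\{c: wc\in\mathcal{L}(\mathbf{x})\}$. $w$ is left special if $\#\mathrm{Lext}(w)\ge2$, right special if $\#\mathrm{Rext}(w)\ge 2$, bispecial if both. The bilateral order is $b(w)=\#\{(c,d): cwd\in\mathcal{L}(\mathbf{x})\}-\#\mathrm{Lext}(w)-\#\mathrm{Rext}(w)+1$. -}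

module Defs where

open import Data.Nat using (ℕ; zero; suc; _+_)
open import Data.Fin using (Fin; zero; suc)
open import Data.List using (List; []; _∷_; _++_; [_]; length; concatMap)
open import Data.List.Membership.Propositional using (_∈_)
open import Data.List.Relation.Unary.Unique.Propositional using (Unique)
open import Data.Product using (Σ; ∃; _×_; _,_)
open import Data.Integer using (ℤ; +_) renaming (_+_ to _+ℤ_; _-_ to _-ℤ_)
open import Function.Bundles using (_⇔_)
open import Relation.Binary.PropositionalEquality using (_≡_; _≢_)

data AB : Set where
  a b : AB

morph : {A B : Set} → (A → List B) → List A → List B
morph f w = concatMap f w

φ : AB → List AB
φ a = a ∷ b ∷ b ∷ a ∷ b ∷ b ∷ a ∷ []
φ b = a ∷ b ∷ a ∷ []

Ψ : AB → List (Fin 3)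
Ψ a = suc zero ∷ suc (suc zero) ∷ []
Ψ b = suc zero ∷ zero ∷ zero ∷ []

φIter : ℕ → List AB
φIter zero = a ∷ []
φIter (suc k) = morph φ (φIter k)

nthD : {A : Set} → A → List A → ℕ → A
nthD d [] _ = d
nthD d (x ∷ xs) zero = x
nthD d (x ∷ xs) (suc i) = nthD d xs i

-- The fixed point u = lim φ^k(a); φ^(i+1)(a) has length ≥ 3^(i+1) > i,
-- and is a prefix of u, so its i-th letter is u_i.
𝐮 : ℕ → AB
𝐮 i = nthD a (φIter (suc i)) i

-- v = Ψ(u); Ψ(φ^(i+1)(a)) is a prefix of Ψ(u) of length > i.
𝐯 : ℕ → Fin 3
𝐯 i = nthD zero (morph Ψ (φIter (suc i))) i

H : List AB → List (Fin 3)
H w = morph Ψ w ++ [ suc zero ]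

window : {A : Set} → (ℕ → A) → ℕ → ℕ → List A
window x i zero = []
window x i (suc n) = x i ∷ window x (suc i) n

Factor : {A : Set} → (ℕ → A) → List A → Set
Factor x w = ∃ λ i → window x i (length w) ≡ w

LeftSpecial : {A : Set} → (ℕ → A) → List A → Set
LeftSpecial x w = Σ _ λ c → Σ _ λ d → c ≢ d × Factor x (c ∷ w) × Factor x (d ∷ w)

RightSpecial : {A : Set} → (ℕ → A) → List A → Set
RightSpecial x w = Σ _ λ c → Σ _ λ d → c ≢ d × Factor x (w ++ [ c ]) × Factor x (w ++ [ d ])

Bispecial : {A : Set} → (ℕ → A) → List A → Set
Bispecial x w = LeftSpecial x w × RightSpecial x w

Card : {A : Set} → (A → Set) → ℕ → Set
Card {A} P k = Σ (List A) λ xs → Unique xs × (∀ y → (y ∈ xs) ⇔ P y) × length xs ≡ k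

BilateralOrder : {A : Set} → (ℕ → A) → List A → ℤ → Set
BilateralOrder {A} x w r =
  Σ ℕ λ kB → Σ ℕ λ kL → Σ ℕ λ kR →
    Card {A × A} (λ { (c , d) → Factor x (c ∷ w ++ [ d ]) }) kB ×
    Card (λ c → Factor x (c ∷ w)) kL ×
    Card (λ d → Factor x (w ++ [ d ])) kR ×
    r ≡ (((+ kB) -ℤ (+ kL)) -ℤ (+ kR)) +ℤ (+ 1)

-- Ψ is a synchronising code: every ₁ in 𝐯 begins a block Ψ(a) = 12 or Ψ(b) = 100, and among
-- the seven factors of length three of 𝐯 a middle letter other than ₁ determines both of its
-- neighbours. So a bispecial factor of 𝐯 must begin and end with ₁, i.e. it is H(w) for a factor w
-- of 𝐮; and the two-sided extensions of H(w) in 𝐯 are exactly ψ(x) H(w) ψ(y), where ψ(x) is the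
-- last letter of Ψ(x) and x w y ranges over the two-sided extensions of w in 𝐮 (similarly on one
-- side). The extension sets of w can be counted because every factor of 𝐮 of length n already
-- occurs in φ^(n+2)(a), which makes factorhood in 𝐮 decidable.

module Submission where

open import Defs
open import Data.Empty using (⊥-elim)
open import Data.Fin as Fin using (Fin; zero; suc)
open import Data.Integer using (ℤ)
open import Data.List using (List; []; _∷_; _++_; [_]; length; concatMap; map; filter; cartesianProduct)
open import Data.List.Properties
  using (length-map; length-++; ++-assoc; ++-identityʳ; ++-cancelʳ; ∷-injective; ∷-injectiveˡ; ∷-injectiveʳ; concatMap-++)
open import Data.List.Membership.Propositional using (_∈_)
open import Data.List.Membership.Propositional.Properties
  using (∈-filter⁺; ∈-filter⁻; ∈-map⁺; ∈-map⁻; ∈-cartesianProduct⁺)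
open import Data.List.Relation.Binary.Pointwise using (≡⇒Pointwise-≡; Pointwise-≡⇒≡)
import Data.List.Relation.Binary.Infix.Heterogeneous as Infixₛ
import Data.List.Relation.Binary.Infix.Heterogeneous.Properties as Infixₛ
open import Data.List.Relation.Unary.All using ([]; _∷_)
open import Data.List.Relation.Unary.AllPairs using ([]; _∷_)
open import Data.List.Relation.Unary.Any using (here; there)
open import Data.List.Relation.Unary.Unique.Propositional using (Unique)
import Data.List.Relation.Unary.Unique.Propositional.Properties as Unique
open import Data.Nat using (ℕ; zero; suc; _+_; _*_; _≤_; _<_; _≤?_; _≤′_; ≤′-refl; ≤′-step; z≤n; s≤s)
open import Data.Nat.Properties
open import Data.Product using (Σ; ∃; ∃₂; _×_; _,_; proj₁; proj₂)
open import Data.Sum using (_⊎_; inj₁; inj₂)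
open import Function.Base using (_∘_)
open import Function.Bundles using (_⇔_; mk⇔; Equivalence)
open import Function.Construct.Composition using (_⇔-∘_)
open import Function.Related.Propositional as Related using (module EquationalReasoning)
open import Relation.Binary.Definitions using (DecidableEquality)
open import Relation.Binary.PropositionalEquality
  using (_≡_; _≢_; refl; sym; trans; cong; cong₂; subst; module ≡-Reasoning)
open import Relation.Nullary using (Dec; yes; no; ¬_)
open import Relation.Nullary.Decidable using (map′; True; toWitness; decidable-stable)
open import Relation.Unary using (Decidable)

pattern ₀ = zero
pattern ₁ = suc zero
pattern ₂ = suc (suc zero)

Infix : {A : Set} → List A → List A → Set
Infix {A} w L = Σ (List A) λ P → Σ (List A) λ S → L ≡ P ++ w ++ S

module _ {A : Set} where

  ++-≡-++ : ∀ (X Y P Z : List A) → X ++ Y ≡ P ++ Z →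
    (∃ λ P′ → P ≡ X ++ P′ × Y ≡ P′ ++ Z) ⊎
    (∃₂ λ t T → X ≡ P ++ t ∷ T × Z ≡ t ∷ T ++ Y)
  ++-≡-++ [] Y P Z eq = inj₁ (P , refl , eq)
  ++-≡-++ (x ∷ X) Y [] Z eq = inj₂ (x , X , refl , sym eq)
  ++-≡-++ (x ∷ X) Y (p ∷ P) Z eq with refl , eq′ ← ∷-injective eq with ++-≡-++ X Y P Z eq′
  ... | inj₁ (P′ , e₁ , e₂) = inj₁ (P′ , cong (x ∷_) e₁ , e₂)
  ... | inj₂ (t , T , e₁ , e₂) = inj₂ (t , T , cong (x ∷_) e₁ , e₂)

  ++-injective-length : ∀ (xs xs′ ys ys′ : List A) → length xs ≡ length xs′ →
    xs ++ ys ≡ xs′ ++ ys′ → xs ≡ xs′ × ys ≡ ys′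
  ++-injective-length [] [] ys ys′ _ eq = refl , eq
  ++-injective-length (x ∷ xs) (x′ ∷ xs′) ys ys′ len eq
    with refl , eq′ ← ∷-injective eq
    with refl , eq″ ← ++-injective-length xs xs′ ys ys′ (suc-injective len) eq′ = refl , eq″

  infix-trans : ∀ {u v L : List A} → Infix u v → Infix v L → Infix u L
  infix-trans {u} (P , S , refl) (P′ , S′ , refl) = P′ ++ P , S ++ S′ , (begin
    P′ ++ (P ++ u ++ S) ++ S′  ≡⟨ cong (P′ ++_) (++-assoc P (u ++ S) S′) ⟩
    P′ ++ P ++ (u ++ S) ++ S′  ≡⟨ cong (λ X → P′ ++ P ++ X) (++-assoc u S S′) ⟩
    P′ ++ P ++ u ++ S ++ S′    ≡⟨ ++-assoc P′ P (u ++ S ++ S′) ⟨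
    (P′ ++ P) ++ u ++ S ++ S′  ∎)
    where open ≡-Reasoning

  length-++-middle : ∀ (P w S : List A) → length P + length w ≤ length (P ++ w ++ S)
  length-++-middle P w S = begin
    length P + length w              ≤⟨ +-monoʳ-≤ (length P) (m≤m+n (length w) (length S)) ⟩
    length P + (length w + length S) ≡⟨ cong (length P +_) (length-++ w) ⟨
    length P + length (w ++ S)       ≡⟨ length-++ P ⟨
    length (P ++ w ++ S)             ∎
    where open ≤-Reasoning

  infix-length : ∀ {w L : List A} → Infix w L → length w ≤ length L
  infix-length {w} (P , S , refl) = ≤-trans (m≤n+m (length w) (length P)) (length-++-middle P w S)

last-two : ∀ {A : Set} (y z : A) t → ∃₂ λ s y′ → ∃ λ z′ → y ∷ z ∷ t ≡ s ++ y′ ∷ z′ ∷ []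
last-two y z [] = [] , y , z , refl
last-two y z (u ∷ t) with s , y′ , z′ , eq ← last-two z u t = y ∷ s , y′ , z′ , cong (y ∷_) eq

infix-concatMap : ∀ {A B : Set} (f : A → List B) {w L} → Infix w L → Infix (concatMap f w) (concatMap f L)
infix-concatMap f {w} (P , S , refl) = concatMap f P , concatMap f S ,
  trans (concatMap-++ f P (w ++ S)) (cong (concatMap f P ++_) (concatMap-++ f w S))

module _ {A : Set} where

  window-suc : ∀ (x : ℕ → A) i n → window x (suc i) n ≡ window (λ j → x (suc j)) i n
  window-suc x i zero = refl
  window-suc x i (suc n) = cong (x (suc i) ∷_) (window-suc x (suc i) n)

  length-window : ∀ (x : ℕ → A) i n → length (window x i n) ≡ n
  length-window x i zero = refl
  length-window x i (suc n) = cong suc (length-window x (suc i) n)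

  window-+ : ∀ (x : ℕ → A) i m n → window x i (m + n) ≡ window x i m ++ window x (i + m) n
  window-+ x i zero n = cong (λ j → window x j n) (sym (+-identityʳ i))
  window-+ x i (suc m) n = cong (x i ∷_)
    (trans (window-+ x (suc i) m n) (cong (λ j → window x (suc i) m ++ window x j n) (sym (+-suc i m))))

  window-cong : ∀ (x y : ℕ → A) i n → (∀ k → k < i + n → x k ≡ y k) → window x i n ≡ window y i n
  window-cong x y i zero _ = refl
  window-cong x y i (suc n) x≗y = cong₂ _∷_ (x≗y i (m<m+n i (s≤s z≤n)))
    (window-cong x y (suc i) n λ k k< → x≗y k (subst (k <_) (sym (+-suc i n)) k<))

  window-nthD-prefix : ∀ (d : A) L n → n ≤ length L → ∃ λ S → L ≡ window (nthD d L) 0 n ++ S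
  window-nthD-prefix d L zero _ = L , refl
  window-nthD-prefix d (c ∷ L) (suc n) (s≤s n≤) with S , eq ← window-nthD-prefix d L n n≤ =
    S , cong (c ∷_) (trans eq (cong (_++ S) (sym (window-suc (nthD d (c ∷ L)) 0 n))))

  window-nthD-infix : ∀ (d : A) L i n → i + n ≤ length L → Infix (window (nthD d L) i n) L
  window-nthD-infix d L zero n n≤ with S , eq ← window-nthD-prefix d L n n≤ = [] , S , eq
  window-nthD-infix d (c ∷ L) (suc i) n (s≤s i+n≤) with P , S , eq ← window-nthD-infix d L i n i+n≤ =
    c ∷ P , S , cong (c ∷_) (trans eq (cong (λ W → P ++ W ++ S) (sym (window-suc (nthD d (c ∷ L)) i n))))

  window-nthD-++ : ∀ (d : A) P w S → window (nthD d (P ++ w ++ S)) (length P) (length w) ≡ w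
  window-nthD-++ d (c ∷ P) w S = trans (window-suc _ (length P) (length w)) (window-nthD-++ d P w S)
  window-nthD-++ d [] [] S = refl
  window-nthD-++ d [] (c ∷ w) S = cong (c ∷_) (trans (window-suc _ 0 (length w)) (window-nthD-++ d [] w S))

  nthD-++ : ∀ (d : A) P Q j → j < length P → nthD d (P ++ Q) j ≡ nthD d P j
  nthD-++ d (c ∷ P) Q zero _ = refl
  nthD-++ d (c ∷ P) Q (suc j) (s≤s j<) = nthD-++ d P Q j j<

  window-length-++ : ∀ (x : ℕ → A) i (s t : List A) →
    window x i (length (s ++ t)) ≡ window x i (length s) ++ window x (i + length s) (length t)
  window-length-++ x i s t = trans (cong (window x i) (length-++ s)) (window-+ x i (length s) (length t))

module _ {A : Set} (x : ℕ → A) where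

  factor-++ : ∀ s t → Factor x (s ++ t) → Factor x s × Factor x t
  factor-++ s t (i , eq)
    with eqˢ , eqᵗ ← ++-injective-length _ s _ t (length-window x i (length s))
                       (trans (sym (window-length-++ x i s t)) eq)
    = (i , eqˢ) , (i + length s , eqᵗ)

  factor-++ˡ : ∀ s t → Factor x (s ++ t) → Factor x s
  factor-++ˡ s t f = proj₁ (factor-++ s t f)

  factor-++ʳ : ∀ s t → Factor x (s ++ t) → Factor x t
  factor-++ʳ s t f = proj₂ (factor-++ s t f)

  factor-++-++ˡ : ∀ s t u → Factor x (s ++ t ++ u) → Factor x (s ++ t)
  factor-++-++ˡ s t u f = factor-++ˡ (s ++ t) u (subst (Factor x) (sym (++-assoc s t u)) f)

  factor-extendʳ : ∀ s → Factor x s → ∃ λ c → Factor x (s ++ [ c ])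
  factor-extendʳ s (i , eq) = x (i + length s) , i ,
    trans (window-length-++ x i s [ _ ]) (cong (_++ [ x (i + length s) ]) eq)

module LimitWord {A : Set} (d : A) (F : ℕ → List A)
                 (F-extends : ∀ m → ∃ λ R → F (suc m) ≡ F m ++ R)
                 (F-long : ∀ m → m < length (F m)) where

  limit : ℕ → A
  limit i = nthD d (F (suc i)) i

  F-prefix : ∀ {m m′} → m ≤′ m′ → ∃ λ R → F m′ ≡ F m ++ R
  F-prefix {m} ≤′-refl = [] , sym (++-identityʳ (F m))
  F-prefix {m} (≤′-step {n} m≤n) with R , eq ← F-prefix m≤n | R′ , eq′ ← F-extends n =
    R ++ R′ , trans eq′ (trans (cong (_++ R′) eq) (++-assoc (F m) R R′))

  nthD-F-stable : ∀ {m m′} j → m ≤ m′ → j < length (F m) → nthD d (F m′) j ≡ nthD d (F m) j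
  nthD-F-stable {m} j m≤m′ j< with R , eq ← F-prefix (≤⇒≤′ m≤m′) =
    trans (cong (λ L → nthD d L j) eq) (nthD-++ d (F m) R j j<)

  limit-agrees : ∀ m j → j < length (F m) → limit j ≡ nthD d (F m) j
  limit-agrees m j j< with ≤-total m (suc j)
  ... | inj₁ m≤ = nthD-F-stable j m≤ j<
  ... | inj₂ ≤m = sym (nthD-F-stable j ≤m (<-trans (n<1+n j) (F-long (suc j))))

  factor⇒infix : ∀ {w} → Factor limit w → ∃ λ m → Infix w (F m)
  factor⇒infix {w} (i , eq) = m , subst (λ W → Infix W (F m)) (trans window-agrees eq)
      (window-nthD-infix d (F m) i (length w) (<⇒≤ (F-long m)))
    where
      m = i + length w
      window-agrees : window (nthD d (F m)) i (length w) ≡ window limit i (length w)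
      window-agrees = window-cong _ _ i (length w) λ k k<m → sym (limit-agrees m k (<-trans k<m (F-long m)))

  infix⇒factor : ∀ {w} m → Infix w (F m) → Factor limit w
  infix⇒factor {w} m (P , S , eq) = length P , (begin
    window limit (length P) (length w)                 ≡⟨ window-cong _ _ (length P) (length w) agrees ⟩
    window (nthD d (F m)) (length P) (length w)        ≡⟨ cong (λ L → window (nthD d L) (length P) (length w)) eq ⟩
    window (nthD d (P ++ w ++ S)) (length P) (length w) ≡⟨ window-nthD-++ d P w S ⟩
    w                                                  ∎)
    where
      open ≡-Reasoning
      P+w≤F : length P + length w ≤ length (F m)
      P+w≤F = subst (length P + length w ≤_) (cong length (sym eq)) (length-++-middle P w S)
      agrees : ∀ k → k < length P + length w → limit k ≡ nthD d (F m) k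
      agrees k k< = limit-agrees m k (<-≤-trans k< P+w≤F)

length-concatMap-≥ : ∀ {A B : Set} (f : A → List B) k → (∀ x → k ≤ length (f x)) →
  ∀ L → length L * k ≤ length (concatMap f L)
length-concatMap-≥ f k f≥k [] = z≤n
length-concatMap-≥ f k f≥k (x ∷ L) = begin
  k + length L * k                       ≤⟨ +-mono-≤ (f≥k x) (length-concatMap-≥ f k f≥k L) ⟩
  length (f x) + length (concatMap f L)  ≡⟨ length-++ (f x) ⟨
  length (concatMap f (x ∷ L))           ∎
  where open ≤-Reasoning

φ-long : ∀ x → 3 ≤ length (φ x)
φ-long a = s≤s (s≤s (s≤s z≤n))
φ-long b = s≤s (s≤s (s≤s z≤n))

Ψ-nonempty : ∀ x → 1 ≤ length (Ψ x)
Ψ-nonempty a = s≤s z≤n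
Ψ-nonempty b = s≤s z≤n

φIter-extends : ∀ m → ∃ λ R → φIter (suc m) ≡ φIter m ++ R
φIter-extends zero = _ , refl
φIter-extends (suc m) with R , eq ← φIter-extends m =
  concatMap φ R , trans (cong (concatMap φ) eq) (concatMap-++ φ (φIter m) R)

φIter-long : ∀ m → m < length (φIter m)
φIter-long zero = s≤s z≤n
φIter-long (suc m) = begin-strict
  suc m                             <⟨ m<m*n (suc m) 3 (s≤s (s≤s z≤n)) ⟩
  suc m * 3                         ≤⟨ *-monoˡ-≤ 3 (φIter-long m) ⟩
  length (φIter m) * 3              ≤⟨ length-concatMap-≥ φ 3 φ-long (φIter m) ⟩
  length (φIter (suc m))            ∎
  where open ≤-Reasoning

Ψφ-extends : ∀ m → ∃ λ R → concatMap Ψ (φIter (suc m)) ≡ concatMap Ψ (φIter m) ++ R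
Ψφ-extends m with R , eq ← φIter-extends m =
  concatMap Ψ R , trans (cong (concatMap Ψ) eq) (concatMap-++ Ψ (φIter m) R)

Ψφ-long : ∀ m → m < length (concatMap Ψ (φIter m))
Ψφ-long m = begin-strict
  m                                   <⟨ φIter-long m ⟩
  length (φIter m)                    ≡⟨ *-identityʳ (length (φIter m)) ⟨
  length (φIter m) * 1                ≤⟨ length-concatMap-≥ Ψ 1 Ψ-nonempty (φIter m) ⟩
  length (concatMap Ψ (φIter m))      ∎
  where open ≤-Reasoning

module 𝐮-limit = LimitWord a φIter φIter-extends φIter-long
module 𝐯-limit = LimitWord ₀ (λ m → concatMap Ψ (φIter m)) Ψφ-extends Ψφ-long

factor-𝐮⇒infix : ∀ {w} → Factor 𝐮 w → ∃ λ m → Infix w (φIter m)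
factor-𝐮⇒infix = 𝐮-limit.factor⇒infix

infix⇒factor-𝐮 : ∀ {w} m → Infix w (φIter m) → Factor 𝐮 w
infix⇒factor-𝐮 = 𝐮-limit.infix⇒factor

factor-𝐯⇒infix : ∀ {v} → Factor 𝐯 v → ∃ λ m → Infix v (concatMap Ψ (φIter m))
factor-𝐯⇒infix = 𝐯-limit.factor⇒infix

infix⇒factor-𝐯 : ∀ {v} m → Infix v (concatMap Ψ (φIter m)) → Factor 𝐯 v
infix⇒factor-𝐯 = 𝐯-limit.infix⇒factor

module Desubstitution {A B : Set} (f : A → List B) (f-long : ∀ x → 3 ≤ length (f x)) where

  prefix-preimage : ∀ L w T → concatMap f L ≡ w ++ T →
    ∃ λ s → (∃ λ R → L ≡ s ++ R) × (∃ λ C → concatMap f s ≡ w ++ C) × length s * 3 ≤ 2 + length w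
  prefix-preimage L [] T _ = [] , (L , refl) , ([] , refl) , z≤n
  prefix-preimage (x ∷ L) (y ∷ w) T eq with ++-≡-++ (f x) (concatMap f L) (y ∷ w) T eq
  ... | inj₂ (t , T′ , fx≡ , _) = x ∷ [] , (L , refl) ,
        (t ∷ T′ , trans (++-identityʳ (f x)) fx≡) , s≤s (s≤s (s≤s z≤n))
  ... | inj₁ (P′ , y∷w≡ , eq′) with s , (R , L≡) , (C , fs≡) , bound ← prefix-preimage L P′ T eq′ =
        x ∷ s , (R , cong (x ∷_) L≡) ,
        (C , trans (cong (f x ++_) fs≡) (trans (sym (++-assoc (f x) P′ C)) (cong (_++ C) (sym y∷w≡)))) ,
        (begin
          3 + length s * 3                ≤⟨ +-monoʳ-≤ 3 bound ⟩
          2 + (3 + length P′)             ≤⟨ +-monoʳ-≤ 2 (+-monoˡ-≤ (length P′) (f-long x)) ⟩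
          2 + (length (f x) + length P′)  ≡⟨ cong (2 +_) (trans (cong length y∷w≡) (length-++ (f x))) ⟨
          2 + length (y ∷ w)              ∎)
    where open ≤-Reasoning

  -- Only the first and the last block of s can stick out of w, and each of them meets w.
  infix-preimage : ∀ L {w} → Infix w (concatMap f L) →
    ∃ λ s → Infix s L × Infix w (concatMap f s) × length s * 3 ≤ 4 + length w
  infix-preimage [] {[]} ([] , [] , refl) = [] , ([] , [] , refl) , ([] , [] , refl) , z≤n
  infix-preimage (x ∷ L) {w} (P , S , eq) with ++-≡-++ (f x) (concatMap f L) P (w ++ S) eq
  ... | inj₁ (P′ , _ , eq′) with s , (Q , R , L≡) , w⊑fs , bound ← infix-preimage L (P′ , S , eq′) =
        s , (x ∷ Q , R , cong (x ∷_) L≡) , w⊑fs , bound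
  infix-preimage (x ∷ L) {w} (P , S , eq) | inj₂ (t , T , fx≡ , eq′)
    with ++-≡-++ w S (t ∷ T) (concatMap f L) eq′
  ... | inj₁ (W , tT≡ , _) = x ∷ [] , ([] , L , refl) ,
        (P , W , trans (++-identityʳ (f x)) (trans fx≡ (cong (P ++_) tT≡))) , s≤s (s≤s (s≤s z≤n))
  ... | inj₂ (t′ , T′ , w≡ , eq″) with s , (R , L≡) , (C , fs≡) , bound ← prefix-preimage L (t′ ∷ T′) S eq″ =
        x ∷ s , ([] , R , cong (x ∷_) L≡) , (P , C , image) , bound′
    where
      image : concatMap f (x ∷ s) ≡ P ++ w ++ C
      image = begin
        f x ++ concatMap f s                ≡⟨ cong₂ _++_ fx≡ fs≡ ⟩
        (P ++ t ∷ T) ++ t′ ∷ T′ ++ C        ≡⟨ ++-assoc P (t ∷ T) _ ⟩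
        P ++ (t ∷ T) ++ t′ ∷ T′ ++ C        ≡⟨ cong (P ++_) (++-assoc (t ∷ T) (t′ ∷ T′) C) ⟨
        P ++ ((t ∷ T) ++ t′ ∷ T′) ++ C      ≡⟨ cong (λ W → P ++ W ++ C) w≡ ⟨
        P ++ w ++ C                         ∎
        where open ≡-Reasoning
      bound′ : suc (length s) * 3 ≤ 4 + length w
      bound′ = begin
        3 + length s * 3                        ≤⟨ +-monoʳ-≤ 3 bound ⟩
        4 + suc (length (t′ ∷ T′))              ≤⟨ +-monoʳ-≤ 4 (s≤s (m≤n+m _ (length T))) ⟩
        4 + (length (t ∷ T) + length (t′ ∷ T′)) ≡⟨ cong (4 +_) (trans (cong length w≡) (length-++ (t ∷ T))) ⟨
        4 + length w                            ∎
        where open ≤-Reasoning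

module _ {A : Set} where

  Infixₛ⇒Infix : ∀ {w L : List A} → Infixₛ.Infix _≡_ w L → Infix w L
  Infixₛ⇒Infix i with Infixₛ.MkView P w′≡w S ← Infixₛ.toView i =
    P , S , cong (λ W → P ++ W ++ S) (sym (Pointwise-≡⇒≡ w′≡w))

  Infix⇒Infixₛ : ∀ {w L : List A} → Infix w L → Infixₛ.Infix _≡_ w L
  Infix⇒Infixₛ (P , S , refl) = Infixₛ.fromView (Infixₛ.MkView P (≡⇒Pointwise-≡ refl) S)

  infix? : DecidableEquality A → (w L : List A) → Dec (Infix w L)
  infix? _≟_ w L = map′ Infixₛ⇒Infix Infix⇒Infixₛ (Infixₛ.infix? _≟_ w L)

_≟ᴬᴮ_ : DecidableEquality AB
a ≟ᴬᴮ a = yes refl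
a ≟ᴬᴮ b = no λ ()
b ≟ᴬᴮ a = no λ ()
b ≟ᴬᴮ b = yes refl

infix-φIter-mono : ∀ {w m m′} → m ≤ m′ → Infix w (φIter m) → Infix w (φIter m′)
infix-φIter-mono m≤m′ w⊑ with R , eq ← 𝐮-limit.F-prefix (≤⇒≤′ m≤m′) = infix-trans w⊑ ([] , R , eq)

infix-φIter₂-by-search : ∀ w {_ : True (infix? _≟ᴬᴮ_ w (φIter 2))} → Infix w (φIter 2)
infix-φIter₂-by-search w {found} = toWitness found

short-infix-φIter₂ : ∀ w → length w ≤ 2 → Infix w (φIter 2)
short-infix-φIter₂ [] _ = [] , _ , refl
short-infix-φIter₂ (a ∷ []) _ = infix-φIter₂-by-search _
short-infix-φIter₂ (b ∷ []) _ = infix-φIter₂-by-search _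
short-infix-φIter₂ (a ∷ a ∷ []) _ = infix-φIter₂-by-search _
short-infix-φIter₂ (a ∷ b ∷ []) _ = infix-φIter₂-by-search _
short-infix-φIter₂ (b ∷ a ∷ []) _ = infix-φIter₂-by-search _
short-infix-φIter₂ (b ∷ b ∷ []) _ = infix-φIter₂-by-search _
short-infix-φIter₂ (_ ∷ _ ∷ _ ∷ _) (s≤s (s≤s ()))

preimage-shorter : ∀ s n → s * 3 ≤ 4 + n → 3 ≤ n → s < n
preimage-shorter s n bound 3≤n = *-cancelʳ-< 3 s n (begin-strict
  s * 3        ≤⟨ bound ⟩
  4 + n        ≡⟨ +-comm 4 n ⟩
  n + 4        <⟨ +-monoʳ-< n (≤-trans (n≤1+n 5) (*-monoˡ-≤ 2 3≤n)) ⟩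
  n + n * 2    ≡⟨ *-suc n 2 ⟨
  n * 3        ∎)
  where open ≤-Reasoning

-- Desubstituting shortens every factor of length at least 3, so descending from φ^m(a)
-- reaches φ^(|w|+2)(a) before reaching the factors of length at most 2.
infix-φIter-bound : ∀ m w → Infix w (φIter m) → Infix w (φIter (length w + 2))
infix-φIter-bound m w w⊑ with length w ≤? 2
... | yes short = infix-φIter-mono (m≤n+m 2 (length w)) (short-infix-φIter₂ w short)
infix-φIter-bound zero w w⊑ | no long = ⊥-elim (long (≤-trans (infix-length w⊑) (s≤s z≤n)))
infix-φIter-bound (suc m) w w⊑ | no long
  with s , s⊑ , w⊑φs , bound ← Desubstitution.infix-preimage φ φ-long (φIter m) w⊑ =
  infix-φIter-mono (+-monoˡ-≤ 2 (preimage-shorter (length s) (length w) bound (≰⇒> long)))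
    (infix-trans w⊑φs (infix-concatMap φ (infix-φIter-bound m s s⊑)))

factor-𝐮? : ∀ w → Dec (Factor 𝐮 w)
factor-𝐮? w = map′ (infix⇒factor-𝐮 (length w + 2)) bounded (infix? _≟ᴬᴮ_ w (φIter (length w + 2)))
  where
    bounded : Factor 𝐮 w → Infix w (φIter (length w + 2))
    bounded f with m , w⊑ ← factor-𝐮⇒infix f = infix-φIter-bound m w w⊑

data Allowed : Fin 3 → Fin 3 → Fin 3 → Set where
  ₁₂₁ : Allowed ₁ ₂ ₁
  ₂₁₂ : Allowed ₂ ₁ ₂
  ₂₁₀ : Allowed ₂ ₁ ₀
  ₁₀₀ : Allowed ₁ ₀ ₀
  ₀₀₁ : Allowed ₀ ₀ ₁
  ₀₁₂ : Allowed ₀ ₁ ₂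
  ₀₁₀ : Allowed ₀ ₁ ₀

allowed-left-unique : ∀ {c d y z} → Allowed c y z → Allowed d y z → y ≢ ₁ → c ≡ d
allowed-left-unique ₁₂₁ ₁₂₁ _ = refl
allowed-left-unique ₁₀₀ ₁₀₀ _ = refl
allowed-left-unique ₀₀₁ ₀₀₁ _ = refl
allowed-left-unique ₂₁₂ _ y≢₁ = ⊥-elim (y≢₁ refl)
allowed-left-unique ₂₁₀ _ y≢₁ = ⊥-elim (y≢₁ refl)
allowed-left-unique ₀₁₂ _ y≢₁ = ⊥-elim (y≢₁ refl)
allowed-left-unique ₀₁₀ _ y≢₁ = ⊥-elim (y≢₁ refl)

allowed-right-unique : ∀ {x y z e} → Allowed x y z → Allowed x y e → y ≢ ₁ → z ≡ e
allowed-right-unique ₁₂₁ ₁₂₁ _ = refl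
allowed-right-unique ₁₀₀ ₁₀₀ _ = refl
allowed-right-unique ₀₀₁ ₀₀₁ _ = refl
allowed-right-unique ₂₁₂ _ y≢₁ = ⊥-elim (y≢₁ refl)
allowed-right-unique ₂₁₀ _ y≢₁ = ⊥-elim (y≢₁ refl)
allowed-right-unique ₀₁₂ _ y≢₁ = ⊥-elim (y≢₁ refl)
allowed-right-unique ₀₁₀ _ y≢₁ = ⊥-elim (y≢₁ refl)

-- M ≡ Ψ(L) as an inductive family, so that equations M ≡ P ++ … can be split by refl patterns.
data ΨCode : List AB → List (Fin 3) → Set where
  [] : ΨCode [] []
  a∷_ : ∀ {L M} → ΨCode L M → ΨCode (a ∷ L) (₁ ∷ ₂ ∷ M)
  b∷_ : ∀ {L M} → ΨCode L M → ΨCode (b ∷ L) (₁ ∷ ₀ ∷ ₀ ∷ M)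

ΨCode-concatMap : ∀ L → ΨCode L (concatMap Ψ L)
ΨCode-concatMap [] = []
ΨCode-concatMap (a ∷ L) = a∷ ΨCode-concatMap L
ΨCode-concatMap (b ∷ L) = b∷ ΨCode-concatMap L

ΨCode-allowed : ∀ {L M} → ΨCode L M → ∀ P S {x y z} → M ≡ P ++ x ∷ y ∷ z ∷ S → Allowed x y z
ΨCode-allowed (a∷ c) (_ ∷ _ ∷ P) S refl = ΨCode-allowed c P S refl
ΨCode-allowed (b∷ c) (_ ∷ _ ∷ _ ∷ P) S refl = ΨCode-allowed c P S refl
ΨCode-allowed (a∷ a∷ c) [] S refl = ₁₂₁
ΨCode-allowed (a∷ b∷ c) [] S refl = ₁₂₁
ΨCode-allowed (a∷ a∷ c) (_ ∷ []) S refl = ₂₁₂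
ΨCode-allowed (a∷ b∷ c) (_ ∷ []) S refl = ₂₁₀
ΨCode-allowed (b∷ c) [] S refl = ₁₀₀
ΨCode-allowed (b∷ a∷ c) (_ ∷ []) S refl = ₀₀₁
ΨCode-allowed (b∷ b∷ c) (_ ∷ []) S refl = ₀₀₁
ΨCode-allowed (b∷ a∷ c) (_ ∷ _ ∷ []) S refl = ₀₁₂
ΨCode-allowed (b∷ b∷ c) (_ ∷ _ ∷ []) S refl = ₀₁₀

factor-𝐯-allowed : ∀ {x y z} → Factor 𝐯 (x ∷ y ∷ z ∷ []) → Allowed x y z
factor-𝐯-allowed f with m , P , S , eq ← factor-𝐯⇒infix f = ΨCode-allowed (ΨCode-concatMap (φIter m)) P S eq

no-₁₁ : ¬ Factor 𝐯 (₁ ∷ ₁ ∷ [])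
no-₁₁ f with _ , f′ ← factor-extendʳ 𝐯 _ f with () ← factor-𝐯-allowed f′

factor-𝐯-extendˡ : ∀ {y t} → y ≢ ₁ → Factor 𝐯 (y ∷ t) → ∃ λ c → Factor 𝐯 (c ∷ y ∷ t)
factor-𝐯-extendˡ y≢₁ (zero , eq) = ⊥-elim (y≢₁ (sym (∷-injectiveˡ eq)))
factor-𝐯-extendˡ y≢₁ (suc i , eq) = 𝐯 i , i , cong (𝐯 i ∷_) eq

forced-extendˡ : ∀ {c y z t} → Allowed c y z → y ≢ ₁ → Factor 𝐯 (y ∷ z ∷ t) → Factor 𝐯 (c ∷ y ∷ z ∷ t)
forced-extendˡ {t = t} cyz y≢₁ f with c′ , f′ ← factor-𝐯-extendˡ y≢₁ f =
  subst (λ c → Factor 𝐯 (c ∷ _)) (allowed-left-unique c′yz cyz y≢₁) f′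
  where c′yz = factor-𝐯-allowed (factor-++ˡ 𝐯 (_ ∷ _ ∷ _ ∷ []) t f′)

forced-extendʳ : ∀ {x y z} s → Allowed x y z → y ≢ ₁ → Factor 𝐯 (s ++ x ∷ y ∷ []) → Factor 𝐯 (s ++ x ∷ y ∷ z ∷ [])
forced-extendʳ {x} {y} s xyz y≢₁ f with e , f′ ← factor-extendʳ 𝐯 _ f =
  subst (λ e → Factor 𝐯 (s ++ x ∷ y ∷ e ∷ [])) (allowed-right-unique xye xyz y≢₁) f″
  where
    f″ = subst (Factor 𝐯) (++-assoc s (x ∷ y ∷ []) [ e ]) f′
    xye = factor-𝐯-allowed (factor-++ʳ 𝐯 s _ f″)

ψ : AB → Fin 3
ψ a = ₂
ψ b = ₀

synchroniseˡ : ∀ x V → Factor 𝐯 (ψ x ∷ ₁ ∷ V) ⇔ Factor 𝐯 (Ψ x ++ ₁ ∷ V)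
synchroniseˡ a V = mk⇔ (forced-extendˡ ₁₂₁ λ ()) (factor-++ʳ 𝐯 [ ₁ ] _)
synchroniseˡ b V = mk⇔ (forced-extendˡ ₁₀₀ (λ ()) ∘ forced-extendˡ ₀₀₁ (λ ())) (factor-++ʳ 𝐯 (₁ ∷ ₀ ∷ []) _)

synchroniseʳ : ∀ x U → Factor 𝐯 (U ++ ₁ ∷ ψ x ∷ []) ⇔ Factor 𝐯 (U ++ Ψ x ++ [ ₁ ])
synchroniseʳ a U = mk⇔ (forced-extendʳ U ₁₂₁ λ ()) (factor-++-++ˡ 𝐯 U (₁ ∷ ₂ ∷ []) [ ₁ ])
synchroniseʳ b U = mk⇔ (split₁ ∘ forced-extendʳ (U ++ [ ₁ ]) ₀₀₁ (λ ()) ∘ join₁ ∘ forced-extendʳ U ₁₀₀ (λ ()))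
                       (factor-++-++ˡ 𝐯 U (₁ ∷ ₀ ∷ []) (₀ ∷ ₁ ∷ []))
  where
    join₁ : ∀ {T} → Factor 𝐯 (U ++ ₁ ∷ T) → Factor 𝐯 ((U ++ [ ₁ ]) ++ T)
    join₁ = subst (Factor 𝐯) (sym (++-assoc U [ ₁ ] _))
    split₁ : ∀ {T} → Factor 𝐯 ((U ++ [ ₁ ]) ++ T) → Factor 𝐯 (U ++ ₁ ∷ T)
    split₁ = subst (Factor 𝐯) (++-assoc U [ ₁ ] _)

H-∷ : ∀ x w → H (x ∷ w) ≡ Ψ x ++ H w
H-∷ x w = ++-assoc (Ψ x) (concatMap Ψ w) [ ₁ ]

H-∷ʳ : ∀ w x → H (w ++ [ x ]) ≡ concatMap Ψ w ++ Ψ x ++ [ ₁ ]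
H-∷ʳ [] a = refl
H-∷ʳ [] b = refl
H-∷ʳ (a ∷ w) x = cong (λ T → ₁ ∷ ₂ ∷ T) (H-∷ʳ w x)
H-∷ʳ (b ∷ w) x = cong (λ T → ₁ ∷ ₀ ∷ ₀ ∷ T) (H-∷ʳ w x)

H-head : ∀ w → ∃ λ Y → H w ≡ ₁ ∷ Y
H-head [] = [] , refl
H-head (a ∷ w) = ₂ ∷ H w , refl
H-head (b ∷ w) = ₀ ∷ ₀ ∷ H w , refl

H-prefix : ∀ w x → ∃ λ T → concatMap Ψ (w ++ [ x ]) ≡ H w ++ T
H-prefix w a = [ ₂ ] , trans (concatMap-++ Ψ w [ a ]) (sym (++-assoc (concatMap Ψ w) [ ₁ ] [ ₂ ]))
H-prefix w b = ₀ ∷ ₀ ∷ [] , trans (concatMap-++ Ψ w [ b ]) (sym (++-assoc (concatMap Ψ w) [ ₁ ] (₀ ∷ ₀ ∷ [])))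

concatMap-Ψ-injective : ∀ {s w} → concatMap Ψ s ≡ concatMap Ψ w → s ≡ w
concatMap-Ψ-injective {[]} {[]} _ = refl
concatMap-Ψ-injective {a ∷ s} {a ∷ w} eq = cong (a ∷_) (concatMap-Ψ-injective (∷-injectiveʳ (∷-injectiveʳ eq)))
concatMap-Ψ-injective {b ∷ s} {b ∷ w} eq =
  cong (b ∷_) (concatMap-Ψ-injective (∷-injectiveʳ (∷-injectiveʳ (∷-injectiveʳ eq))))
concatMap-Ψ-injective {[]} {a ∷ w} ()
concatMap-Ψ-injective {[]} {b ∷ w} ()
concatMap-Ψ-injective {a ∷ s} {[]} ()
concatMap-Ψ-injective {a ∷ s} {b ∷ w} ()
concatMap-Ψ-injective {b ∷ s} {[]} ()
concatMap-Ψ-injective {b ∷ s} {a ∷ w} ()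

H-injective : ∀ s w → H s ≡ H w → s ≡ w
H-injective s w eq = concatMap-Ψ-injective (++-cancelʳ [ ₁ ] (concatMap Ψ s) (concatMap Ψ w) eq)

block-boundary : ∀ {L M} → ΨCode L M → ∀ q S → M ≡ q ++ ₁ ∷ S →
  ∃₂ λ w L′ → L ≡ w ++ L′ × q ≡ concatMap Ψ w × ΨCode L′ (₁ ∷ S)
block-boundary (a∷ c) [] S refl = [] , _ , refl , refl , a∷ c
block-boundary (b∷ c) [] S refl = [] , _ , refl , refl , b∷ c
block-boundary (a∷ c) (_ ∷ _ ∷ q) S refl with w , L′ , L≡ , q≡ , c′ ← block-boundary c q S refl =
  a ∷ w , L′ , cong (a ∷_) L≡ , cong (λ T → ₁ ∷ ₂ ∷ T) q≡ , c′
block-boundary (b∷ c) (_ ∷ _ ∷ _ ∷ q) S refl with w , L′ , L≡ , q≡ , c′ ← block-boundary c q S refl =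
  b ∷ w , L′ , cong (b ∷_) L≡ , cong (λ T → ₁ ∷ ₀ ∷ ₀ ∷ T) q≡ , c′

parse-H : ∀ {L r} q → Infix (₁ ∷ r) (concatMap Ψ L) → ₁ ∷ r ≡ q ++ [ ₁ ] → ∃ λ w → ₁ ∷ r ≡ H w × Infix w L
parse-H {L} {r} q (P , S , eq) r≡
  with L₀ , L₁ , L≡ , _ , c ← block-boundary (ΨCode-concatMap L) P (r ++ S) eq
  with w , L′ , L₁≡ , q≡ , _ ← block-boundary c q S (trans (cong (_++ S) r≡) (++-assoc q [ ₁ ] S))
  = w , trans r≡ (cong (_++ [ ₁ ]) q≡) , L₀ , L′ , trans L≡ (cong (L₀ ++_) L₁≡)

factor-𝐯⇒H : ∀ {r} q → Factor 𝐯 (₁ ∷ r) → ₁ ∷ r ≡ q ++ [ ₁ ] → ∃ λ w → Factor 𝐮 w × ₁ ∷ r ≡ H w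
factor-𝐯⇒H q f r≡ with m , r⊑ ← factor-𝐯⇒infix f with w , r≡H , w⊑ ← parse-H q r⊑ r≡ =
  w , infix⇒factor-𝐮 m w⊑ , r≡H

factor-H⇔ : ∀ w → Factor 𝐯 (H w) ⇔ Factor 𝐮 w
factor-H⇔ w = mk⇔ to from
  where
    to : Factor 𝐯 (H w) → Factor 𝐮 w
    to f with Y , eY ← H-head w = parsed (factor-𝐯⇒H (concatMap Ψ w) (subst (Factor 𝐯) eY f) (sym eY))
      where
        parsed : (∃ λ w′ → Factor 𝐮 w′ × ₁ ∷ Y ≡ H w′) → Factor 𝐮 w
        parsed (w′ , f′ , Y≡) = subst (Factor 𝐮) (sym (H-injective w w′ (trans eY Y≡))) f′
    from : Factor 𝐮 w → Factor 𝐯 (H w)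
    from f with x , f′ ← factor-extendʳ 𝐮 w f
           with m , w⊑ ← factor-𝐮⇒infix f′
           with T , eq ← H-prefix w x =
      factor-++ˡ 𝐯 (H w) T (subst (Factor 𝐯) eq (infix⇒factor-𝐯 m (infix-concatMap Ψ w⊑)))

left-extension-H⇔ : ∀ x w → Factor 𝐯 (ψ x ∷ H w) ⇔ Factor 𝐮 (x ∷ w)
left-extension-H⇔ x w with Y , eY ← H-head w = begin
  Factor 𝐯 (ψ x ∷ H w)    ≡⟨ cong (λ V → Factor 𝐯 (ψ x ∷ V)) eY ⟩
  Factor 𝐯 (ψ x ∷ ₁ ∷ Y)  ∼⟨ synchroniseˡ x Y ⟩
  Factor 𝐯 (Ψ x ++ ₁ ∷ Y) ≡⟨ cong (λ V → Factor 𝐯 (Ψ x ++ V)) eY ⟨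
  Factor 𝐯 (Ψ x ++ H w)   ≡⟨ cong (Factor 𝐯) (H-∷ x w) ⟨
  Factor 𝐯 (H (x ∷ w))    ∼⟨ factor-H⇔ (x ∷ w) ⟩
  Factor 𝐮 (x ∷ w)        ∎
  where open EquationalReasoning {k = Related.equivalence}

H-∷ʳ-split : ∀ U w d → U ++ H w ++ [ d ] ≡ (U ++ concatMap Ψ w) ++ ₁ ∷ d ∷ []
H-∷ʳ-split U w d = trans (cong (U ++_) (++-assoc (concatMap Ψ w) [ ₁ ] [ d ])) (sym (++-assoc U _ _))

synchronise-H : ∀ U w x → Factor 𝐯 (U ++ H w ++ [ ψ x ]) ⇔ Factor 𝐯 (U ++ H (w ++ [ x ]))
synchronise-H U w x = begin
  Factor 𝐯 (U ++ H w ++ [ ψ x ])                  ≡⟨ cong (Factor 𝐯) (H-∷ʳ-split U w (ψ x)) ⟩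
  Factor 𝐯 ((U ++ concatMap Ψ w) ++ ₁ ∷ ψ x ∷ []) ∼⟨ synchroniseʳ x (U ++ concatMap Ψ w) ⟩
  Factor 𝐯 ((U ++ concatMap Ψ w) ++ Ψ x ++ [ ₁ ]) ≡⟨ cong (Factor 𝐯) (++-assoc U _ _) ⟩
  Factor 𝐯 (U ++ concatMap Ψ w ++ Ψ x ++ [ ₁ ])   ≡⟨ cong (λ V → Factor 𝐯 (U ++ V)) (H-∷ʳ w x) ⟨
  Factor 𝐯 (U ++ H (w ++ [ x ]))                  ∎
  where open EquationalReasoning {k = Related.equivalence}

right-extension-H⇔ : ∀ w x → Factor 𝐯 (H w ++ [ ψ x ]) ⇔ Factor 𝐮 (w ++ [ x ])
right-extension-H⇔ w x = factor-H⇔ (w ++ [ x ]) ⇔-∘ synchronise-H [] w x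

bi-extension-H⇔ : ∀ x w y → Factor 𝐯 (ψ x ∷ H w ++ [ ψ y ]) ⇔ Factor 𝐮 (x ∷ w ++ [ y ])
bi-extension-H⇔ x w y = left-extension-H⇔ x (w ++ [ y ]) ⇔-∘ synchronise-H [ ψ x ] w y

H-not-preceded-by-₁ : ∀ c w → Factor 𝐯 (c ∷ H w) → c ≢ ₁
H-not-preceded-by-₁ c w f refl with Y , eY ← H-head w =
  no-₁₁ (factor-++ˡ 𝐯 (₁ ∷ ₁ ∷ []) Y (subst (λ V → Factor 𝐯 (₁ ∷ V)) eY f))

H-not-followed-by-₁ : ∀ U w d → Factor 𝐯 (U ++ H w ++ [ d ]) → d ≢ ₁
H-not-followed-by-₁ U w d f refl = no-₁₁ (factor-++ʳ 𝐯 (U ++ concatMap Ψ w) _ (subst (Factor 𝐯) (H-∷ʳ-split U w ₁) f))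

ψ-preimage : ∀ {c} → c ≢ ₁ → ∃ λ x → c ≡ ψ x
ψ-preimage {₀} _ = b , refl
ψ-preimage {₁} c≢₁ = ⊥-elim (c≢₁ refl)
ψ-preimage {₂} _ = a , refl

ψ-injective : ∀ {x y} → ψ x ≡ ψ y → x ≡ y
ψ-injective {a} {a} _ = refl
ψ-injective {b} {b} _ = refl

ψ² : AB × AB → Fin 3 × Fin 3
ψ² (x , y) = ψ x , ψ y

ψ²-injective : ∀ {p q} → ψ² p ≡ ψ² q → p ≡ q
ψ²-injective eq = cong₂ _,_ (ψ-injective (cong proj₁ eq)) (ψ-injective (cong proj₂ eq))

left-extensions-H : ∀ w c → Factor 𝐯 (c ∷ H w) ⇔ (∃ λ x → c ≡ ψ x × Factor 𝐮 (x ∷ w))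
left-extensions-H w c = mk⇔ to from
  where
    to : Factor 𝐯 (c ∷ H w) → ∃ λ x → c ≡ ψ x × Factor 𝐮 (x ∷ w)
    to f with x , refl ← ψ-preimage (H-not-preceded-by-₁ c w f) = x , refl , Equivalence.to (left-extension-H⇔ x w) f
    from : (∃ λ x → c ≡ ψ x × Factor 𝐮 (x ∷ w)) → Factor 𝐯 (c ∷ H w)
    from (x , refl , f) = Equivalence.from (left-extension-H⇔ x w) f

right-extensions-H : ∀ w d → Factor 𝐯 (H w ++ [ d ]) ⇔ (∃ λ x → d ≡ ψ x × Factor 𝐮 (w ++ [ x ]))
right-extensions-H w d = mk⇔ to from
  where
    to : Factor 𝐯 (H w ++ [ d ]) → ∃ λ x → d ≡ ψ x × Factor 𝐮 (w ++ [ x ])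
    to f with x , refl ← ψ-preimage (H-not-followed-by-₁ [] w d f) = x , refl , Equivalence.to (right-extension-H⇔ w x) f
    from : (∃ λ x → d ≡ ψ x × Factor 𝐮 (w ++ [ x ])) → Factor 𝐯 (H w ++ [ d ])
    from (x , refl , f) = Equivalence.from (right-extension-H⇔ w x) f

bi-extensions-H : ∀ w c d → Factor 𝐯 (c ∷ H w ++ [ d ]) ⇔
  (∃ λ p → (c , d) ≡ ψ² p × Factor 𝐮 (proj₁ p ∷ w ++ [ proj₂ p ]))
bi-extensions-H w c d = mk⇔ to from
  where
    to : Factor 𝐯 (c ∷ H w ++ [ d ]) → ∃ λ p → (c , d) ≡ ψ² p × Factor 𝐮 (proj₁ p ∷ w ++ [ proj₂ p ])
    to f with x , refl ← ψ-preimage (H-not-preceded-by-₁ c w (factor-++ˡ 𝐯 (c ∷ H w) [ d ] f))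
         with y , refl ← ψ-preimage (H-not-followed-by-₁ [ c ] w d f) =
      (x , y) , refl , Equivalence.to (bi-extension-H⇔ x w y) f
    from : (∃ λ p → (c , d) ≡ ψ² p × Factor 𝐮 (proj₁ p ∷ w ++ [ proj₂ p ])) → Factor 𝐯 (c ∷ H w ++ [ d ])
    from ((x , y) , refl , f) = Equivalence.from (bi-extension-H⇔ x w y) f

Listing : Set → Set
Listing A = Σ (List A) λ xs → Unique xs × (∀ y → y ∈ xs)

listing-× : ∀ {A B : Set} → Listing A → Listing B → Listing (A × B)
listing-× (xs , xs! , ∈xs) (ys , ys! , ∈ys) =
  cartesianProduct xs ys , Unique.cartesianProduct⁺ xs! ys! , λ (x , y) → ∈-cartesianProduct⁺ (∈xs x) (∈ys y)

AB-listing : Listing AB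
AB-listing = a ∷ b ∷ [] , ((λ ()) ∷ []) ∷ [] ∷ [] , λ { a → here refl ; b → there (here refl) }

card-decidable : ∀ {A : Set} → Listing A → {P : A → Set} → Decidable P → ∃ (Card P)
card-decidable (xs , xs! , ∈xs) P? = length (filter P? xs) , filter P? xs , Unique.filter⁺ P? xs! ,
  (λ y → mk⇔ (proj₂ ∘ ∈-filter⁻ P? {xs = xs}) (∈-filter⁺ P? (∈xs y))) , refl

card-map : ∀ {A B : Set} {P : A → Set} {Q : B → Set} {k} (f : A → B) → (∀ {x y} → f x ≡ f y → x ≡ y) →
  (∀ y → Q y ⇔ (∃ λ x → y ≡ f x × P x)) → Card P k → Card Q k
card-map {P = P} {Q} f f-injective Q⇔ (xs , xs! , ∈xs⇔ , len) =
  map f xs , Unique.map⁺ f-injective xs! , (λ y → mk⇔ (to y) (from y)) , trans (length-map f xs) len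
  where
    to : ∀ y → y ∈ map f xs → Q y
    to y y∈ with x , x∈ , refl ← ∈-map⁻ f y∈ = Equivalence.from (Q⇔ (f x)) (x , refl , Equivalence.to (∈xs⇔ x) x∈)
    from : ∀ y → Q y → y ∈ map f xs
    from y q with x , refl , p ← Equivalence.to (Q⇔ y) q = ∈-map⁺ f (Equivalence.from (∈xs⇔ x) p)

bilateral-order-H : ∀ w → Σ ℤ λ r → BilateralOrder 𝐮 w r × BilateralOrder 𝐯 (H w) r
bilateral-order-H w =
  _ , (proj₁ bi , proj₁ left , proj₁ right , proj₂ bi , proj₂ left , proj₂ right , refl) ,
      (proj₁ bi , proj₁ left , proj₁ right ,
       card-map ψ² ψ²-injective (λ (c , d) → bi-extensions-H w c d) (proj₂ bi) ,
       card-map ψ ψ-injective (left-extensions-H w) (proj₂ left) ,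
       card-map ψ ψ-injective (right-extensions-H w) (proj₂ right) , refl)
  where
    bi : ∃ (Card {AB × AB} λ (c , d) → Factor 𝐮 (c ∷ w ++ [ d ]))
    bi = card-decidable (listing-× AB-listing AB-listing) λ (c , d) → factor-𝐮? (c ∷ w ++ [ d ])
    left : ∃ (Card λ c → Factor 𝐮 (c ∷ w))
    left = card-decidable AB-listing λ c → factor-𝐮? (c ∷ w)
    right : ∃ (Card λ d → Factor 𝐮 (w ++ [ d ]))
    right = card-decidable AB-listing λ d → factor-𝐮? (w ++ [ d ])

left-special-head : ∀ {y z t} → LeftSpecial 𝐯 (y ∷ z ∷ t) → y ≡ ₁
left-special-head {y} {z} {t} (c , d , c≢d , fc , fd) =
  decidable-stable (y Fin.≟ ₁) λ y≢₁ → c≢d (allowed-left-unique (triple fc) (triple fd) y≢₁)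
  where
    triple : ∀ {e} → Factor 𝐯 (e ∷ y ∷ z ∷ t) → Allowed e y z
    triple f = factor-𝐯-allowed (factor-++ˡ 𝐯 (_ ∷ _ ∷ _ ∷ []) t f)

right-special-last : ∀ {s y z} → RightSpecial 𝐯 (s ++ y ∷ z ∷ []) → z ≡ ₁
right-special-last {s} {y} {z} (e , f , e≢f , fe , ff) =
  decidable-stable (z Fin.≟ ₁) λ z≢₁ → e≢f (allowed-right-unique (triple fe) (triple ff) z≢₁)
  where
    triple : ∀ {e} → Factor 𝐯 ((s ++ y ∷ z ∷ []) ++ [ e ]) → Allowed y z e
    triple f = factor-𝐯-allowed (factor-++ʳ 𝐯 s _ (subst (Factor 𝐯) (++-assoc s _ _) f))

bispecial⇒H : ∀ y z t → Bispecial 𝐯 (y ∷ z ∷ t) → ∃ λ w → Factor 𝐮 w × y ∷ z ∷ t ≡ H w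
bispecial⇒H y z t (left@(c , _ , _ , fc , _) , right) with refl ← left-special-head left =
  ends-with-₁ (last-two ₁ z t)
  where
    ends-with-₁ : (∃₂ λ s y′ → ∃ λ z′ → ₁ ∷ z ∷ t ≡ s ++ y′ ∷ z′ ∷ []) →
      ∃ λ w → Factor 𝐮 w × ₁ ∷ z ∷ t ≡ H w
    ends-with-₁ (s , y′ , z′ , split) with refl ← right-special-last (subst (RightSpecial 𝐯) split right) =
      factor-𝐯⇒H (s ++ [ y′ ]) (factor-++ʳ 𝐯 [ c ] _ fc) (trans split (sym (++-assoc s [ y′ ] [ ₁ ])))

lemma7 : (v : List (Fin 3)) → 3 ≤ length v → Bispecial 𝐯 v →
    Σ (List AB) (λ w → Factor 𝐮 w × v ≡ H w ×
      Σ ℤ (λ r → BilateralOrder 𝐮 w r × BilateralOrder 𝐯 (H w) r))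
lemma7 (_ ∷ []) (s≤s ()) _
lemma7 (y ∷ z ∷ t) _ bispecial =
  let w , w-factor , v≡Hw = bispecial⇒H y z t bispecial
  in w , w-factor , v≡Hw , bilateral-order-H w
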